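{- Let $T$ be a semi-Nelson algebra (with $0:=\sim 1$). Then the set of h-implicative filters of $T$ coincides with the set of N-implicative filters of $T$.
   Context: Write $x\rightarrow_N y$ for $x\rightarrow(x\wedge y)$. A semi-Nelson algebra is an algebra $\langle T,\wedge,\vee,\rightarrow,\sim,1\rangle$ of type $(2,2,2,1,0)$ such that for all $x,y,z\in T$: (SN1) $x\wedge(x\vee y)=x$; (SN2) $x\wedge(y\vee z)=(z\wedge x)\vee(y\wedge x)$; (SN3) $\sim\sim x=x$; (SN4) $\sim(x\wedge y)=\sim x\vee\sim y$; (SN5) $x\wedge\sim x=(x\wedge\sim x)\wedge(y\vee\sim y)$; (SN6) $x\wedge(x\rightarrow_N y)=x\wedge(\sim x\vee y)$; (SN7) $x\rightarrow_N(y\rightarrow_N z)=(x\wedge y)\rightarrow_N z$; (SN8) $(x\rightarrow_N y)\rightarrow_N[(y\rightarrow_N x)\rightarrow_N[(x\rightarrow z)\rightarrow_N(y\rightarrow z)]]=1$; (SN9) $(x\rightarrow_N y)\rightarrow_N[(y\rightarrow_N x)\rightarrow_N[(z\rightarrow x)\rightarrow_N(z\rightarrow y)]]=1$; (SN10) $\sim(x\rightarrow y)\rightarrow_N(x\wedge\sim y)=1$; (SN11) $(x\wedge\sim y)\rightarrow_N\sim(x\rightarrow y)=1$. A subset $F\subseteq T$ is an implicative filter if $1\in F$ and for all $x,y\in T$, if $x\in F$ and $x\rightarrow y\in F$ then $y\in F$. An implicative filter $F$ is an h-implicative filter if for all $x,y\in T$ and $f\in F$: (F1) $(x\rightarrow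 y)\rightarrow((x\wedge f)\rightarrow(y\wedge f))\in F$; (F2) $((x\wedge f)\rightarrow(y\wedge f))\rightarrow(x\rightarrow y)\in F$; (F3) $\sim(x\rightarrow y)\rightarrow\sim((x\wedge f)\rightarrow(y\wedge f))\in F$; (F4) $\sim((x\wedge f)\rightarrow(y\wedge f))\rightarrow\sim(x\rightarrow y)\in F$. A subset $F\subseteq T$ is an N-implicative filter if $1\in F$ and for all $x,y\in T$, if $x\in F$ and $x\rightarrow_N y\in F$ then $y\in F$. -}

module Defs where

open import Level using (Level; suc; _⊔_)
open import Relation.Binary.PropositionalEquality using (_≡_)
open import Relation.Unary using (Pred; _∈_)
open import Data.Product using (_×_)

record SemiNelsonAlgebra (c : Level) : Set (suc c) where
  infixr 7 _∧_
  infixr 6 _∨_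
  infixr 5 _⇒_ _⇒N_
  field
    T   : Set c
    _∧_ : T → T → T
    _∨_ : T → T → T
    _⇒_ : T → T → T
    ∼_  : T → T
    𝟙   : T

  _⇒N_ : T → T → T
  x ⇒N y = x ⇒ (x ∧ y)

  field
    SN1  : ∀ x y → x ∧ (x ∨ y) ≡ x
    SN2  : ∀ x y z → x ∧ (y ∨ z) ≡ (z ∧ x) ∨ (y ∧ x)
    SN3  : ∀ x → ∼ (∼ x) ≡ x
    SN4  : ∀ x y → ∼ (x ∧ y) ≡ (∼ x) ∨ (∼ y)
    SN5  : ∀ x y → x ∧ (∼ x) ≡ (x ∧ (∼ x)) ∧ (y ∨ (∼ y))
    SN6  : ∀ x y → x ∧ (x ⇒N y) ≡ x ∧ ((∼ x) ∨ y)
    SN7  : ∀ x y z → x ⇒N (y ⇒N z) ≡ (x ∧ y) ⇒N z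
    SN8  : ∀ x y z →
      (x ⇒N y) ⇒N ((y ⇒N x) ⇒N ((x ⇒ z) ⇒N (y ⇒ z))) ≡ 𝟙
    SN9  : ∀ x y z →
      (x ⇒N y) ⇒N ((y ⇒N x) ⇒N ((z ⇒ x) ⇒N (z ⇒ y))) ≡ 𝟙
    SN10 : ∀ x y → (∼ (x ⇒ y)) ⇒N (x ∧ (∼ y)) ≡ 𝟙
    SN11 : ∀ x y → (x ∧ (∼ y)) ⇒N (∼ (x ⇒ y)) ≡ 𝟙

  𝟘 : T
  𝟘 = ∼ 𝟙

module _ {c : Level} (A : SemiNelsonAlgebra c) where
  open SemiNelsonAlgebra A

  record IsImplicativeFilter {ℓ : Level} (F : Pred T ℓ) : Set (c ⊔ ℓ) where
    field
      one∈ : 𝟙 ∈ F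
      mp   : ∀ x y → x ∈ F → (x ⇒ y) ∈ F → y ∈ F

  record IsHImplicativeFilter {ℓ : Level} (F : Pred T ℓ) : Set (c ⊔ ℓ) where
    field
      implicative : IsImplicativeFilter F
      F1 : ∀ x y f → f ∈ F → ((x ⇒ y) ⇒ ((x ∧ f) ⇒ (y ∧ f))) ∈ F
      F2 : ∀ x y f → f ∈ F → (((x ∧ f) ⇒ (y ∧ f)) ⇒ (x ⇒ y)) ∈ F
      F3 : ∀ x y f → f ∈ F → ((∼ (x ⇒ y)) ⇒ (∼ ((x ∧ f) ⇒ (y ∧ f)))) ∈ F
      F4 : ∀ x y f → f ∈ F → ((∼ ((x ∧ f) ⇒ (y ∧ f))) ⇒ (∼ (x ⇒ y))) ∈ F

  record IsNImplicativeFilter {ℓ : Level} (F : Pred T ℓ) : Set (c ⊔ ℓ) where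
    field
      one∈ : 𝟙 ∈ F
      mpN  : ∀ x y → x ∈ F → (x ⇒N y) ∈ F → y ∈ F

{-# OPTIONS --safe #-}
-- For an N-implicative filter F write x ≈F y when x →N y and y →N x both lie in F. Axioms
-- SN8 and SN9 make ≈F an equivalence and → a congruence for it, and x ≈F x ∧ f for f ∈ F;
-- SN10 and SN11 give ∼ (x → y) ≈F x ∧ ∼ y. Thus the two sides of each of F1–F4 are
-- ≈F-equivalent, and F contains x → y whenever x ≈F y, because x → x = 1. Conversely, in an
-- h-implicative filter, F2 with x := 1 and f := x ∧ y shows that x ∧ y ∈ F forces y ∈ F, which
-- turns modus ponens for → into modus ponens for →N.
module Submission where

open import Defs
open import Level using (Level)
open import Algebra.Core using (Op₂)
open import Algebra.Bundles using (IdempotentCommutativeMonoid)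
open import Data.Product using (_×_; _,_; swap)
open import Relation.Binary.Core using (Rel)
open import Relation.Binary.PropositionalEquality
open import Relation.Unary using (Pred; _∈_)

-- Sholander's axioms SN1–SN2 force a distributive lattice. Associativity of ∧ needs the order:
-- x ∧ y is a greatest lower bound because x ≤ y ⇔ x ∨ y ≡ y and ∨ distributes over ∧.
module SholanderLattice {a} {A : Set a} (_∧_ _∨_ : Op₂ A)
  (∧-absorbs-∨ : ∀ x y → x ∧ (x ∨ y) ≡ x)
  (∧-distrib-∨ : ∀ x y z → x ∧ (y ∨ z) ≡ (z ∧ x) ∨ (y ∧ x))
  where

  open import Algebra.Definitions (_≡_ {A = A})
  open ≡-Reasoning

  infix 4 _≤_
  _≤_ : Rel A a
  x ≤ y = x ∧ y ≡ x

  private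
    ∧-split : ∀ x y → (y ∧ x) ∨ (x ∧ x) ≡ x
    ∧-split x y = trans (sym (∧-distrib-∨ x x y)) (∧-absorbs-∨ x y)

  x∧y≤y : ∀ x y → x ∧ y ≤ y
  x∧y≤y x y = trans (cong ((x ∧ y) ∧_) (sym (∧-split y x))) (∧-absorbs-∨ (x ∧ y) (y ∧ y))

  private
    ∧-self-split : ∀ x y → x ∧ x ≡ (x ∧ x) ∨ (y ∧ x)
    ∧-self-split x y = begin
      x ∧ x                          ≡⟨ cong (x ∧_) (∧-split x y) ⟨
      x ∧ ((y ∧ x) ∨ (x ∧ x))        ≡⟨ ∧-distrib-∨ x (y ∧ x) (x ∧ x) ⟩
      ((x ∧ x) ∧ x) ∨ ((y ∧ x) ∧ x)  ≡⟨ cong₂ _∨_ (x∧y≤y x x) (x∧y≤y y x) ⟩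
      (x ∧ x) ∨ (y ∧ x)              ∎

  ∧-idem : Idempotent _∧_
  ∧-idem x = trans (∧-self-split x x) (∧-split x x)

  ∨-idem : Idempotent _∨_
  ∨-idem x = begin
    x ∨ x              ≡⟨ cong₂ _∨_ (∧-idem x) (∧-idem x) ⟨
    (x ∧ x) ∨ (x ∧ x)  ≡⟨ ∧-self-split x x ⟨
    x ∧ x              ≡⟨ ∧-idem x ⟩
    x                  ∎

  ∧-comm : Commutative _∧_
  ∧-comm x y = begin
    x ∧ y              ≡⟨ cong (x ∧_) (∨-idem y) ⟨
    x ∧ (y ∨ y)        ≡⟨ ∧-distrib-∨ x y y ⟩
    (y ∧ x) ∨ (y ∧ x)  ≡⟨ ∨-idem (y ∧ x) ⟩
    y ∧ x              ∎

  ∨-absorbs-∧ : ∀ x y → x ∨ (x ∧ y) ≡ x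
  ∨-absorbs-∧ x y = begin
    x ∨ (x ∧ y)        ≡⟨ cong₂ _∨_ (∧-idem x) (∧-comm y x) ⟨
    (x ∧ x) ∨ (y ∧ x)  ≡⟨ ∧-self-split x y ⟨
    x ∧ x              ≡⟨ ∧-idem x ⟩
    x                  ∎

  x≤x∨y : ∀ x y → x ≤ x ∨ y
  x≤x∨y = ∧-absorbs-∨

  y≤x∨y : ∀ x y → y ≤ x ∨ y
  y≤x∨y x y = begin
    y ∧ (x ∨ y)        ≡⟨ ∧-distrib-∨ y x y ⟩
    (y ∧ y) ∨ (x ∧ y)  ≡⟨ cong₂ _∨_ (∧-idem y) (∧-comm x y) ⟩
    y ∨ (y ∧ x)        ≡⟨ ∨-absorbs-∧ y x ⟩
    y                  ∎

  ∨-comm : Commutative _∨_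
  ∨-comm x y = begin
    x ∨ y              ≡⟨ join x y ⟨
    (x ∨ y) ∧ (y ∨ x)  ≡⟨ ∧-comm (x ∨ y) (y ∨ x) ⟩
    (y ∨ x) ∧ (x ∨ y)  ≡⟨ join y x ⟩
    y ∨ x              ∎
    where
    join : ∀ x y → (x ∨ y) ∧ (y ∨ x) ≡ x ∨ y
    join x y = trans (∧-distrib-∨ (x ∨ y) y x) (cong₂ _∨_ (x≤x∨y x y) (y≤x∨y x y))

  ∧-distribˡ-∨ : ∀ x y z → x ∧ (y ∨ z) ≡ (x ∧ y) ∨ (x ∧ z)
  ∧-distribˡ-∨ x y z = begin
    x ∧ (y ∨ z)        ≡⟨ ∧-distrib-∨ x y z ⟩
    (z ∧ x) ∨ (y ∧ x)  ≡⟨ ∨-comm (z ∧ x) (y ∧ x) ⟩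
    (y ∧ x) ∨ (z ∧ x)  ≡⟨ cong₂ _∨_ (∧-comm y x) (∧-comm z x) ⟩
    (x ∧ y) ∨ (x ∧ z)  ∎

  x∧y≤x : ∀ x y → x ∧ y ≤ x
  x∧y≤x x y = begin
    (x ∧ y) ∧ x  ≡⟨ cong (_∧ x) (∧-comm x y) ⟩
    (y ∧ x) ∧ x  ≡⟨ x∧y≤y y x ⟩
    y ∧ x        ≡⟨ ∧-comm y x ⟩
    x ∧ y        ∎

  ≤-antisym : ∀ {x y} → x ≤ y → y ≤ x → x ≡ y
  ≤-antisym {x} {y} x≤y y≤x = trans (sym x≤y) (trans (∧-comm x y) y≤x)

  x≤y⇒x∨y≡y : ∀ {x y} → x ≤ y → x ∨ y ≡ y
  x≤y⇒x∨y≡y {x} {y} x≤y = begin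
    x ∨ y        ≡⟨ cong (_∨ y) x≤y ⟨
    (x ∧ y) ∨ y  ≡⟨ ∨-comm (x ∧ y) y ⟩
    y ∨ (x ∧ y)  ≡⟨ cong (y ∨_) (∧-comm x y) ⟩
    y ∨ (y ∧ x)  ≡⟨ ∨-absorbs-∧ y x ⟩
    y            ∎

  x∨y≡y⇒x≤y : ∀ {x y} → x ∨ y ≡ y → x ≤ y
  x∨y≡y⇒x≤y {x} {y} x∨y≡y = trans (cong (x ∧_) (sym x∨y≡y)) (∧-absorbs-∨ x y)

  x≤y⇒x≤y∨z : ∀ {x y} z → x ≤ y → x ≤ y ∨ z
  x≤y⇒x≤y∨z {x} {y} z x≤y = begin
    x ∧ (y ∨ z)        ≡⟨ ∧-distribˡ-∨ x y z ⟩
    (x ∧ y) ∨ (x ∧ z)  ≡⟨ cong (_∨ (x ∧ z)) x≤y ⟩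
    x ∨ (x ∧ z)        ≡⟨ ∨-absorbs-∧ x z ⟩
    x                  ∎

  x≤z⇒x≤y∨z : ∀ {x z} y → x ≤ z → x ≤ y ∨ z
  x≤z⇒x≤y∨z {x} {z} y x≤z = begin
    x ∧ (y ∨ z)  ≡⟨ cong (x ∧_) (∨-comm y z) ⟩
    x ∧ (z ∨ y)  ≡⟨ x≤y⇒x≤y∨z y x≤z ⟩
    x            ∎

  ∨-least : ∀ {x y z} → x ≤ z → y ≤ z → x ∨ y ≤ z
  ∨-least {x} {y} {z} x≤z y≤z = begin
    (x ∨ y) ∧ z        ≡⟨ ∧-comm (x ∨ y) z ⟩
    z ∧ (x ∨ y)        ≡⟨ ∧-distribˡ-∨ z x y ⟩
    (z ∧ x) ∨ (z ∧ y)  ≡⟨ cong₂ _∨_ (trans (∧-comm z x) x≤z) (trans (∧-comm z y) y≤z) ⟩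
    x ∨ y              ∎

  ∨-assoc : Associative _∨_
  ∨-assoc x y z = ≤-antisym
    (∨-least (∨-least (x≤x∨y x (y ∨ z)) (x≤z⇒x≤y∨z x (x≤x∨y y z))) (x≤z⇒x≤y∨z x (y≤x∨y y z)))
    (∨-least (x≤y⇒x≤y∨z z (x≤x∨y x y)) (∨-least (x≤y⇒x≤y∨z z (y≤x∨y x y)) (y≤x∨y (x ∨ y) z)))

  ∨-distribˡ-∧ : ∀ x y z → x ∨ (y ∧ z) ≡ (x ∨ y) ∧ (x ∨ z)
  ∨-distribˡ-∧ x y z = sym (begin
    (x ∨ y) ∧ (x ∨ z)                ≡⟨ ∧-distribˡ-∨ (x ∨ y) x z ⟩
    ((x ∨ y) ∧ x) ∨ ((x ∨ y) ∧ z)    ≡⟨ cong₂ _∨_ (trans (∧-comm (x ∨ y) x) (x≤x∨y x y))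
                                                  (trans (∧-comm (x ∨ y) z) (∧-distribˡ-∨ z x y)) ⟩
    x ∨ ((z ∧ x) ∨ (z ∧ y))          ≡⟨ ∨-assoc x (z ∧ x) (z ∧ y) ⟨
    (x ∨ (z ∧ x)) ∨ (z ∧ y)          ≡⟨ cong₂ _∨_ (trans (cong (x ∨_) (∧-comm z x)) (∨-absorbs-∧ x z))
                                                  (∧-comm z y) ⟩
    x ∨ (y ∧ z)                      ∎)

  ≤-trans : ∀ {x y z} → x ≤ y → y ≤ z → x ≤ z
  ≤-trans {x} {y} {z} x≤y y≤z = x∨y≡y⇒x≤y (begin
    x ∨ z        ≡⟨ cong (x ∨_) (x≤y⇒x∨y≡y y≤z) ⟨
    x ∨ (y ∨ z)  ≡⟨ ∨-assoc x y z ⟨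
    (x ∨ y) ∨ z  ≡⟨ cong (_∨ z) (x≤y⇒x∨y≡y x≤y) ⟩
    y ∨ z        ≡⟨ x≤y⇒x∨y≡y y≤z ⟩
    z            ∎)

  ∧-greatest : ∀ {x y z} → z ≤ x → z ≤ y → z ≤ x ∧ y
  ∧-greatest {x} {y} {z} z≤x z≤y = x∨y≡y⇒x≤y
    (trans (∨-distribˡ-∧ z x y) (cong₂ _∧_ (x≤y⇒x∨y≡y z≤x) (x≤y⇒x∨y≡y z≤y)))

  ∧-assoc : Associative _∧_
  ∧-assoc x y z = ≤-antisym
    (∧-greatest (≤-trans (x∧y≤x (x ∧ y) z) (x∧y≤x x y))
                (∧-greatest (≤-trans (x∧y≤x (x ∧ y) z) (x∧y≤y x y)) (x∧y≤y (x ∧ y) z)))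
    (∧-greatest (∧-greatest (x∧y≤x x (y ∧ z)) (≤-trans (x∧y≤y x (y ∧ z)) (x∧y≤x y z)))
                (≤-trans (x∧y≤y x (y ∧ z)) (x∧y≤y y z)))

module SemiNelsonProperties {c} (A : SemiNelsonAlgebra c) where

  open SemiNelsonAlgebra A
  open SholanderLattice _∧_ _∨_ SN1 SN2 public
  open ≡-Reasoning

  ⇒N-contract : ∀ x y → x ⇒N (x ⇒N y) ≡ x ⇒N y
  ⇒N-contract x y = trans (SN7 x x y) (cong (_⇒N y) (∧-idem x))

  ∧-⇒N-self : ∀ x → x ∧ (x ⇒N x) ≡ x
  ∧-⇒N-self x = trans (SN6 x x) (trans (cong (x ∧_) (∨-comm (∼ x) x)) (SN1 x (∼ x)))

  ⇒N-self-refl : ∀ x → (x ⇒N x) ⇒N (x ⇒N x) ≡ 𝟙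
  ⇒N-self-refl x = begin
    e ⇒N e                                ≡⟨ ⇒N-contract e e ⟨
    e ⇒N (e ⇒N e)                         ≡⟨ cong (e ⇒N_) (⇒N-contract e e) ⟨
    e ⇒N (e ⇒N (e ⇒N e))                  ≡⟨ cong (λ z → e ⇒N (e ⇒N (z ⇒N z))) (cong (x ⇒_) (∧-idem x)) ⟩
    e ⇒N (e ⇒N ((x ⇒ x) ⇒N (x ⇒ x)))      ≡⟨ SN8 x x x ⟩
    𝟙                                     ∎
    where e = x ⇒N x

  ∧-identityʳ : ∀ x → x ∧ 𝟙 ≡ x
  ∧-identityʳ x = begin
    x ∧ 𝟙               ≡⟨ cong (_∧ 𝟙) (∧-⇒N-self x) ⟨
    (x ∧ e) ∧ 𝟙         ≡⟨ ∧-assoc x e 𝟙 ⟩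
    x ∧ (e ∧ 𝟙)         ≡⟨ cong (λ z → x ∧ (e ∧ z)) (⇒N-self-refl x) ⟨
    x ∧ (e ∧ (e ⇒N e))  ≡⟨ cong (x ∧_) (∧-⇒N-self e) ⟩
    x ∧ e               ≡⟨ ∧-⇒N-self x ⟩
    x                   ∎
    where e = x ⇒N x

  ∧-identityˡ : ∀ x → 𝟙 ∧ x ≡ x
  ∧-identityˡ x = trans (∧-comm 𝟙 x) (∧-identityʳ x)

  ∨-identityˡ : ∀ x → 𝟘 ∨ x ≡ x
  ∨-identityˡ x = begin
    ∼ 𝟙 ∨ x        ≡⟨ cong (∼ 𝟙 ∨_) (SN3 x) ⟨
    ∼ 𝟙 ∨ ∼ (∼ x)  ≡⟨ SN4 𝟙 (∼ x) ⟨
    ∼ (𝟙 ∧ ∼ x)    ≡⟨ cong ∼_ (∧-identityˡ (∼ x)) ⟩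
    ∼ (∼ x)        ≡⟨ SN3 x ⟩
    x              ∎

  ⇒N-identityˡ : ∀ x → 𝟙 ⇒N x ≡ x
  ⇒N-identityˡ x = begin
    𝟙 ⇒N x        ≡⟨ ∧-identityˡ (𝟙 ⇒N x) ⟨
    𝟙 ∧ (𝟙 ⇒N x)  ≡⟨ SN6 𝟙 x ⟩
    𝟙 ∧ (𝟘 ∨ x)   ≡⟨ ∧-identityˡ (𝟘 ∨ x) ⟩
    𝟘 ∨ x         ≡⟨ ∨-identityˡ x ⟩
    x             ∎

  ⇒-identityˡ : ∀ x → 𝟙 ⇒ x ≡ x
  ⇒-identityˡ x = trans (cong (𝟙 ⇒_) (sym (∧-identityˡ x))) (⇒N-identityˡ x)

  ⇒N-refl : ∀ x → x ⇒N x ≡ 𝟙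
  ⇒N-refl x = begin
    x ⇒N x                                              ≡⟨ ⇒N-identityˡ (x ⇒N x) ⟨
    𝟙 ⇒N (x ⇒N x)                                       ≡⟨ ⇒N-identityˡ (𝟙 ⇒N (x ⇒N x)) ⟨
    𝟙 ⇒N (𝟙 ⇒N (x ⇒N x))                                ≡⟨ cong₂ (λ u v → u ⇒N (u ⇒N (v ⇒N v)))
                                                                  (⇒N-identityˡ 𝟙) (⇒-identityˡ x) ⟨
    (𝟙 ⇒N 𝟙) ⇒N ((𝟙 ⇒N 𝟙) ⇒N ((𝟙 ⇒ x) ⇒N (𝟙 ⇒ x)))     ≡⟨ SN8 𝟙 𝟙 x ⟩
    𝟙                                                   ∎

  ⇒-refl : ∀ x → x ⇒ x ≡ 𝟙
  ⇒-refl x = trans (cong (x ⇒_) (sym (∧-idem x))) (⇒N-refl x)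

  ≤⇒⇒N≡𝟙 : ∀ {x y} → x ≤ y → x ⇒N y ≡ 𝟙
  ≤⇒⇒N≡𝟙 {x} x≤y = trans (cong (x ⇒_) x≤y) (⇒-refl x)

  ⇒N-zeroʳ : ∀ x → x ⇒N 𝟙 ≡ 𝟙
  ⇒N-zeroʳ x = ≤⇒⇒N≡𝟙 (∧-identityʳ x)

  ⇒N-restrict : ∀ {x y} z → x ≤ y → x ⇒N (y ∧ z) ≡ x ⇒N z
  ⇒N-restrict {x} {y} z x≤y = cong (x ⇒_) (trans (sym (∧-assoc x y z)) (cong (_∧ z) x≤y))

  ⇒N-weakening : ∀ x y → x ⇒N (y ⇒N x) ≡ 𝟙
  ⇒N-weakening x y = trans (SN7 x y x) (≤⇒⇒N≡𝟙 (x∧y≤x x y))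

  ⇒N-strengthen : ∀ x {y z} → y ⇒N z ≡ 𝟙 → (x ∧ y) ⇒N z ≡ 𝟙
  ⇒N-strengthen x {y} {z} y⇒Nz≡𝟙 =
    trans (sym (SN7 x y z)) (trans (cong (x ⇒N_) y⇒Nz≡𝟙) (⇒N-zeroʳ x))

  ⇒N-mp : ∀ x y → (x ∧ (x ⇒N y)) ⇒N y ≡ 𝟙
  ⇒N-mp x y = begin
    (x ∧ (x ⇒N y)) ⇒N y  ≡⟨ cong (_⇒N y) (∧-comm x (x ⇒N y)) ⟩
    ((x ⇒N y) ∧ x) ⇒N y  ≡⟨ SN7 (x ⇒N y) x y ⟨
    (x ⇒N y) ⇒N (x ⇒N y) ≡⟨ ⇒N-refl (x ⇒N y) ⟩
    𝟙                    ∎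

  ∼x≤∼[x∧y] : ∀ x y → ∼ x ≤ ∼ (x ∧ y)
  ∼x≤∼[x∧y] x y = trans (cong (∼ x ∧_) (SN4 x y)) (SN1 (∼ x) (∼ y))

  ∧-idempotentCommutativeMonoid : IdempotentCommutativeMonoid c c
  ∧-idempotentCommutativeMonoid = record
    { Carrier = T ; _≈_ = _≡_ ; _∙_ = _∧_ ; ε = 𝟙
    ; isIdempotentCommutativeMonoid = record
      { isCommutativeMonoid = record
        { isMonoid = record
          { isSemigroup = record
            { isMagma = record { isEquivalence = isEquivalence ; ∙-cong = cong₂ _∧_ }
            ; assoc = ∧-assoc }
          ; identity = ∧-identityˡ , ∧-identityʳ }
        ; comm = ∧-comm }
      ; idem = ∧-idem } }

module NImplicativeFilter {c ℓ} {A : SemiNelsonAlgebra c} {F : Pred (SemiNelsonAlgebra.T A) ℓ}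
  (isNImplicative : IsNImplicativeFilter A F) where

  open SemiNelsonAlgebra A
  open SemiNelsonProperties A
  open IsNImplicativeFilter isNImplicative
  open import Algebra.Solver.IdempotentCommutativeMonoid ∧-idempotentCommutativeMonoid
    using (solve; _⊜_; _⊕_)
  open ≡-Reasoning

  private variable x y z f : T

  ≡𝟙⇒∈ : x ≡ 𝟙 → x ∈ F
  ≡𝟙⇒∈ x≡𝟙 = subst F (sym x≡𝟙) one∈

  mpN₂ : x ∈ F → y ∈ F → x ⇒N (y ⇒N z) ≡ 𝟙 → z ∈ F
  mpN₂ x∈F y∈F x⇒Ny⇒Nz≡𝟙 = mpN _ _ y∈F (mpN _ _ x∈F (≡𝟙⇒∈ x⇒Ny⇒Nz≡𝟙))

  ⇒N-weaken : y ∈ F → (x ⇒N y) ∈ F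
  ⇒N-weaken {y} {x} y∈F = mpN y (x ⇒N y) y∈F (≡𝟙⇒∈ (⇒N-weakening y x))

  infix 4 _≈F_
  _≈F_ : Rel T ℓ
  x ≈F y = (x ⇒N y) ∈ F × (y ⇒N x) ∈ F

  ≈F-sym : x ≈F y → y ≈F x
  ≈F-sym = swap

  ∈-resp-≈F : x ≈F y → x ∈ F → y ∈ F
  ∈-resp-≈F (x⇒Ny , _) x∈F = mpN _ _ x∈F x⇒Ny

  ⇒-congˡ : x ≈F y → (x ⇒ z) ≈F (y ⇒ z)
  ⇒-congˡ {x} {y} {z} (x⇒Ny , y⇒Nx) = mpN₂ x⇒Ny y⇒Nx (SN8 x y z) , mpN₂ y⇒Nx x⇒Ny (SN8 y x z)

  ⇒-congʳ : x ≈F y → (z ⇒ x) ≈F (z ⇒ y)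
  ⇒-congʳ {x} {y} {z} (x⇒Ny , y⇒Nx) = mpN₂ x⇒Ny y⇒Nx (SN9 x y z) , mpN₂ y⇒Nx x⇒Ny (SN9 y x z)

  ⇒N-trans : (x ⇒N y) ∈ F → (y ⇒N z) ∈ F → (x ⇒N z) ∈ F
  ⇒N-trans {x} {y} {z} x⇒Ny y⇒Nz =
    ∈-resp-≈F (⇒-congʳ xyz≈xz) (∈-resp-≈F (⇒-congˡ xy≈x) (subst F (SN7 x y z) (⇒N-weaken y⇒Nz)))
    where
    xy≈x : x ∧ y ≈F x
    xy≈x = ≡𝟙⇒∈ (≤⇒⇒N≡𝟙 (x∧y≤x x y)) , subst F (sym (⇒N-restrict y (∧-idem x))) x⇒Ny

    z⇒Nx⇒Ny≡ : z ⇒N (x ⇒N y) ≡ (x ∧ z) ⇒N ((x ∧ y) ∧ z)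
    z⇒Nx⇒Ny≡ = trans (SN7 z x y) (cong₂ _⇒_ (∧-comm z x)
      (solve 3 (λ x y z → (z ⊕ x) ⊕ y ⊜ (x ⊕ z) ⊕ ((x ⊕ y) ⊕ z)) refl x y z))

    xyz≈xz : (x ∧ y) ∧ z ≈F x ∧ z
    xyz≈xz = ≡𝟙⇒∈ (≤⇒⇒N≡𝟙 (solve 3 (λ x y z → ((x ⊕ y) ⊕ z) ⊕ (x ⊕ z) ⊜ (x ⊕ y) ⊕ z) refl x y z))
           , subst F z⇒Nx⇒Ny≡ (⇒N-weaken x⇒Ny)

  ≈F-trans : x ≈F y → y ≈F z → x ≈F z
  ≈F-trans (x⇒Ny , y⇒Nx) (y⇒Nz , z⇒Ny) = ⇒N-trans x⇒Ny y⇒Nz , ⇒N-trans z⇒Ny y⇒Nx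

  ⇒-cong : ∀ {x x′ y y′} → x ≈F x′ → y ≈F y′ → (x ⇒ y) ≈F (x′ ⇒ y′)
  ⇒-cong x≈x′ y≈y′ = ≈F-trans (⇒-congˡ x≈x′) (⇒-congʳ y≈y′)

  ≈F⇒⇒∈ : x ≈F y → (x ⇒ y) ∈ F
  ≈F⇒⇒∈ {x} x≈y = ∈-resp-≈F (⇒-congʳ x≈y) (≡𝟙⇒∈ (⇒-refl x))

  ≈F-∧ : f ∈ F → x ≈F x ∧ f
  ≈F-∧ {f} {x} f∈F = subst F (sym (⇒N-restrict f (∧-idem x))) (⇒N-weaken f∈F)
                   , ≡𝟙⇒∈ (≤⇒⇒N≡𝟙 (x∧y≤x x f))

  mp : ∀ x y → x ∈ F → (x ⇒ y) ∈ F → y ∈ F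
  mp x y x∈F x⇒y = mpN x y x∈F (subst F (cong (x ⇒_) (∧-comm y x)) (∈-resp-≈F (⇒-congʳ (≈F-∧ x∈F)) x⇒y))

  ∼⇒≈F : ∼ (x ⇒ y) ≈F x ∧ ∼ y
  ∼⇒≈F {x} {y} = ≡𝟙⇒∈ (SN10 x y) , ≡𝟙⇒∈ (SN11 x y)

  ∧∼-≈F : f ∈ F → x ∧ ∼ y ≈F (x ∧ f) ∧ ∼ (y ∧ f)
  ∧∼-≈F {f} {x} {y} f∈F = subst F (cong (X ⇒_) (sym X∧Y≡X∧f)) (⇒N-weaken f∈F) , ≡𝟙⇒∈ Y⇒NX≡𝟙
    where
    X = x ∧ ∼ y
    Y = (x ∧ f) ∧ ∼ (y ∧ f)
    Z = f ∧ (f ⇒N ∼ y)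

    X∧Y≡X∧f : X ∧ Y ≡ X ∧ f
    X∧Y≡X∧f = begin
      (x ∧ ∼ y) ∧ ((x ∧ f) ∧ ∼ (y ∧ f))  ≡⟨ solve 4 (λ x u f v → (x ⊕ u) ⊕ ((x ⊕ f) ⊕ v) ⊜ (x ⊕ f) ⊕ (u ⊕ v))
                                                     refl x (∼ y) f (∼ (y ∧ f)) ⟩
      (x ∧ f) ∧ (∼ y ∧ ∼ (y ∧ f))        ≡⟨ cong ((x ∧ f) ∧_) (∼x≤∼[x∧y] y f) ⟩
      (x ∧ f) ∧ ∼ y                      ≡⟨ solve 3 (λ x u f → (x ⊕ f) ⊕ u ⊜ (x ⊕ u) ⊕ f) refl x (∼ y) f ⟩
      (x ∧ ∼ y) ∧ f                      ∎

    Y≡x∧Z : Y ≡ x ∧ Z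
    Y≡x∧Z = begin
      (x ∧ f) ∧ ∼ (y ∧ f)    ≡⟨ cong ((x ∧ f) ∧_) (trans (SN4 y f) (∨-comm (∼ y) (∼ f))) ⟩
      (x ∧ f) ∧ (∼ f ∨ ∼ y)  ≡⟨ ∧-assoc x f (∼ f ∨ ∼ y) ⟩
      x ∧ (f ∧ (∼ f ∨ ∼ y))  ≡⟨ cong (x ∧_) (SN6 f (∼ y)) ⟨
      x ∧ Z                  ∎

    Y⇒NX≡𝟙 : Y ⇒N X ≡ 𝟙
    Y⇒NX≡𝟙 = begin
      Y ⇒N X                ≡⟨ cong (_⇒N X) Y≡x∧Z ⟩
      (x ∧ Z) ⇒N (x ∧ ∼ y)  ≡⟨ ⇒N-restrict (∼ y) (x∧y≤x x Z) ⟩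
      (x ∧ Z) ⇒N ∼ y        ≡⟨ ⇒N-strengthen x (⇒N-mp f (∼ y)) ⟩
      𝟙                     ∎

  ⇒-∧-≈F : f ∈ F → (x ⇒ y) ≈F ((x ∧ f) ⇒ (y ∧ f))
  ⇒-∧-≈F f∈F = ⇒-cong (≈F-∧ f∈F) (≈F-∧ f∈F)

  ∼⇒-∧-≈F : f ∈ F → ∼ (x ⇒ y) ≈F ∼ ((x ∧ f) ⇒ (y ∧ f))
  ∼⇒-∧-≈F f∈F = ≈F-trans ∼⇒≈F (≈F-trans (∧∼-≈F f∈F) (≈F-sym ∼⇒≈F))

  isHImplicativeFilter : IsHImplicativeFilter A F
  isHImplicativeFilter = record
    { implicative = record { one∈ = one∈ ; mp = mp }
    ; F1 = λ _ _ _ f∈F → ≈F⇒⇒∈ (⇒-∧-≈F f∈F)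
    ; F2 = λ _ _ _ f∈F → ≈F⇒⇒∈ (≈F-sym (⇒-∧-≈F f∈F))
    ; F3 = λ _ _ _ f∈F → ≈F⇒⇒∈ (∼⇒-∧-≈F f∈F)
    ; F4 = λ _ _ _ f∈F → ≈F⇒⇒∈ (≈F-sym (∼⇒-∧-≈F f∈F))
    }

module HImplicativeFilter {c ℓ} {A : SemiNelsonAlgebra c} {F : Pred (SemiNelsonAlgebra.T A) ℓ}
  (isHImplicative : IsHImplicativeFilter A F) where

  open SemiNelsonAlgebra A
  open SemiNelsonProperties A
  open IsHImplicativeFilter isHImplicative
  open IsImplicativeFilter implicative
  open ≡-Reasoning

  ∧-elimʳ : ∀ {x y} → (x ∧ y) ∈ F → y ∈ F
  ∧-elimʳ {x} {y} x∧y∈F = subst F F2-instance≡y (F2 𝟙 y (x ∧ y) x∧y∈F)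
    where
    F2-instance≡y : ((𝟙 ∧ (x ∧ y)) ⇒ (y ∧ (x ∧ y))) ⇒ (𝟙 ⇒ y) ≡ y
    F2-instance≡y = begin
      ((𝟙 ∧ (x ∧ y)) ⇒ (y ∧ (x ∧ y))) ⇒ (𝟙 ⇒ y)  ≡⟨ cong₂ (λ u v → (u ⇒ v) ⇒ (𝟙 ⇒ y)) (∧-identityˡ (x ∧ y))
                                                          (trans (∧-comm y (x ∧ y)) (x∧y≤y x y)) ⟩
      ((x ∧ y) ⇒ (x ∧ y)) ⇒ (𝟙 ⇒ y)              ≡⟨ cong (_⇒ (𝟙 ⇒ y)) (⇒-refl (x ∧ y)) ⟩
      𝟙 ⇒ (𝟙 ⇒ y)                                ≡⟨ ⇒-identityˡ (𝟙 ⇒ y) ⟩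
      𝟙 ⇒ y                                      ≡⟨ ⇒-identityˡ y ⟩
      y                                          ∎

  isNImplicativeFilter : IsNImplicativeFilter A F
  isNImplicativeFilter = record
    { one∈ = one∈
    ; mpN  = λ x y x∈F x⇒Ny∈F → ∧-elimʳ (mp x (x ∧ y) x∈F x⇒Ny∈F)
    }

proposition46 : {c ℓ : Level} (A : SemiNelsonAlgebra c) (F : Pred (SemiNelsonAlgebra.T A) ℓ) → (IsHImplicativeFilter A F → IsNImplicativeFilter A F) × (IsNImplicativeFilter A F → IsHImplicativeFilter A F)
proposition46 A F = HImplicativeFilter.isNImplicativeFilter , NImplicativeFilter.isHImplicativeFilter
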